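{- Consider majority logic circuits over primary inputs $a,b,c_{in}$: acyclic networks of majority gates $M_k$ (each of arbitrary odd fan-in $k$, where $M_k$ outputs $1$ iff at least $\lceil k/2\rceil$ of its inputs are $1$) whose inputs are primary inputs, constants $0,1$, or outputs of other gates, each possibly complemented, and whose outputs are gate outputs, possibly complemented; inverters are not counted as majority operators. The full-adder is the two-output function $sum=a\oplus b\oplus c_{in}$, $c_{out}=M_3(a,b,c_{in})$. The circuit with the two gates $m=M_3(a,b,c_{in})$ and $sum=M_5(a,\neg m,\neg m,b,c_{in})$, with $c_{out}=m$, implements the full-adder and has the minimum number of majority operators (namely two) among all majority logic circuits implementing the full-adder. -}

module Defs where

open import Data.Nat using (ℕ; zero; suc; _*_; _≤ᵇ_; ⌈_/2⌉; _≤_)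
open import Data.Bool using (Bool; true; false; not; _xor_)
open import Data.Fin using (Fin; zero; suc)
open import Data.Vec using (Vec; []; _∷_; _∷ʳ_; lookup)
open import Data.Product using (∃; _×_; _,_)
open import Relation.Binary.PropositionalEquality using (_≡_; refl)

countTrue : ∀ {k} → Vec Bool k → ℕ
countTrue [] = 0
countTrue (true ∷ v) = suc (countTrue v)
countTrue (false ∷ v) = countTrue v

maj : ∀ {k} → Vec Bool k → Bool
maj {k} v = ⌈ k /2⌉ ≤ᵇ countTrue v

-- Signal sources available to a gate with index i (gates are listed in a
-- topological order, so gate i may only read gates 0 .. i-1: acyclicity).
-- Primary inputs: 0 = a, 1 = b, 2 = c_in.
data Src (i : ℕ) : Set where
  inp   : Fin 3 → Src i
  const : Bool → Src i
  gate  : Fin i → Src i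

record Lit (i : ℕ) : Set where
  constructor lit
  field
    neg : Bool
    src : Src i

record Gate (i : ℕ) : Set where
  constructor mkGate
  field
    fanIn  : ℕ
    odd    : ∃ λ m → fanIn ≡ suc (2 * m)
    inputs : Vec (Lit i) fanIn

data Circuit : ℕ → Set where
  []  : Circuit 0
  _▷_ : ∀ {n} → Circuit n → Gate n → Circuit (suc n)

record OutLit (n : ℕ) : Set where
  constructor out
  field
    outNeg : Bool
    outGate : Fin n

evalSrc : ∀ {i} → Vec Bool 3 → Vec Bool i → Src i → Bool
evalSrc ρ vs (inp x)   = lookup ρ x
evalSrc ρ vs (const b) = b
evalSrc ρ vs (gate j)  = lookup vs j

evalLit : ∀ {i} → Vec Bool 3 → Vec Bool i → Lit i → Bool
evalLit ρ vs (lit n s) = n xor evalSrc ρ vs s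

evalLits : ∀ {i k} → Vec Bool 3 → Vec Bool i → Vec (Lit i) k → Vec Bool k
evalLits ρ vs [] = []
evalLits ρ vs (l ∷ ls) = evalLit ρ vs l ∷ evalLits ρ vs ls

evalGate : ∀ {i} → Vec Bool 3 → Vec Bool i → Gate i → Bool
evalGate ρ vs (mkGate k _ ins) = maj (evalLits ρ vs ins)

evalCircuit : ∀ {n} → Circuit n → Vec Bool 3 → Vec Bool n
evalCircuit [] ρ = []
evalCircuit (c ▷ g) ρ = let vs = evalCircuit c ρ in vs ∷ʳ evalGate ρ vs g

evalOut : ∀ {n} → Circuit n → Vec Bool 3 → OutLit n → Bool
evalOut c ρ (out n j) = n xor lookup (evalCircuit c ρ) j

ImplementsFullAdder : ∀ {n} → Circuit n → OutLit n → OutLit n → Set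
ImplementsFullAdder c s co =
  ∀ a b cin →
    (evalOut c (a ∷ b ∷ cin ∷ []) s ≡ (a xor b) xor cin)
    × (evalOut c (a ∷ b ∷ cin ∷ []) co ≡ maj (a ∷ b ∷ cin ∷ []))

pos : ∀ {i} → Src i → Lit i
pos = lit false
ngt : ∀ {i} → Src i → Lit i
ngt = lit true

A B Cin : Fin 3
A = zero
B = suc zero
Cin = suc (suc zero)

faCircuit : Circuit 2
faCircuit =
  ([] ▷ mkGate 3 (1 , refl) (pos (inp A) ∷ pos (inp B) ∷ pos (inp Cin) ∷ []))
      ▷ mkGate 5 (2 , refl)
          (pos (inp A) ∷ ngt (gate zero) ∷ ngt (gate zero) ∷ pos (inp B) ∷ pos (inp Cin) ∷ [])

faSum faCout : OutLit 2
faSum  = out false (suc zero)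
faCout = out false zero

-- Every circuit output is a possibly
-- complemented gate output, so two outputs reading the same gate differ by a
-- constant complementation: their xor does not depend on the primary inputs
-- (`sameGate-xor-constant`).  For the full adder, however, sum ⊕ c_out is not
-- constant: it is 0 on (0,0,0) and 1 on (1,0,0) (`fullAdder-xor-varies`).
-- Hence sum and c_out must be read from different gates.  A circuit with no
-- gates has no outputs at all, and in a circuit with a single gate every
-- output reads that gate, so at least two majority gates are needed.
module Submission where

open import Defs
open import Data.Nat using (_≤_; z≤n; s≤s; suc; zero)
open import Data.Product using (_×_; _,_; proj₁; proj₂)
open import Data.Bool using (Bool; true; false; _xor_)
open import Data.Vec using (Vec; []; _∷_)
open import Data.Fin as Fin using (Fin)
open import Data.Empty using (⊥)
open import Relation.Binary.PropositionalEquality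
  using (_≡_; refl; sym; cong₂; module ≡-Reasoning)

faCircuit-correct : ImplementsFullAdder faCircuit faSum faCout
faCircuit-correct false false false = refl , refl
faCircuit-correct false false true  = refl , refl
faCircuit-correct false true  false = refl , refl
faCircuit-correct false true  true  = refl , refl
faCircuit-correct true  false false = refl , refl
faCircuit-correct true  false true  = refl , refl
faCircuit-correct true  true  false = refl , refl
faCircuit-correct true  true  true  = refl , refl

xor-cancelʳ : ∀ s t v → (s xor v) xor (t xor v) ≡ s xor t
xor-cancelʳ false false false = refl
xor-cancelʳ false false true  = refl
xor-cancelʳ false true  false = refl
xor-cancelʳ false true  true  = refl
xor-cancelʳ true  false false = refl
xor-cancelʳ true  false true  = refl
xor-cancelʳ true  true  false = refl
xor-cancelʳ true  true  true  = refl

sameGate-xor-constant : ∀ {n} (c : Circuit n) (ρ : Vec Bool 3) (s t : Bool) (j : Fin n) →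
  evalOut c ρ (out s j) xor evalOut c ρ (out t j) ≡ s xor t
sameGate-xor-constant c ρ s t j = xor-cancelʳ s t _

outputsXor : ∀ {n} → Circuit n → OutLit n → OutLit n → (a b cin : Bool) → Bool
outputsXor c s co a b cin =
  evalOut c (a ∷ b ∷ cin ∷ []) s xor evalOut c (a ∷ b ∷ cin ∷ []) co

fullAdder-xor-varies : ∀ {n} (c : Circuit n) (s co : OutLit n) → ImplementsFullAdder c s co →
  outputsXor c s co false false false ≡ false × outputsXor c s co true false false ≡ true
fullAdder-xor-varies c s co impl = xorAt false false false , xorAt true false false
  where
  xorAt : ∀ a b cin → outputsXor c s co a b cin ≡ ((a xor b) xor cin) xor maj (a ∷ b ∷ cin ∷ [])
  xorAt a b cin = cong₂ _xor_ (proj₁ (impl a b cin)) (proj₂ (impl a b cin))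

-- Hence no full adder reads both of its outputs from the same gate: the xor
-- of the outputs would be the constant s ⊕ t, yet it takes both values.
fullAdder-outputs-distinct-gates : ∀ {n} (c : Circuit n) (s t : Bool) (j : Fin n) →
  ImplementsFullAdder c (out s j) (out t j) → ⊥
fullAdder-outputs-distinct-gates c s t j impl
  with fullAdder-xor-varies c (out s j) (out t j) impl
... | at000 , at100 = false≢true (begin
  false                                              ≡⟨ sym at000 ⟩
  outputsXor c (out s j) (out t j) false false false ≡⟨ sameGate-xor-constant c _ s t j ⟩
  s xor t                                            ≡⟨ sym (sameGate-xor-constant c _ s t j) ⟩
  outputsXor c (out s j) (out t j) true  false false ≡⟨ at100 ⟩
  true                                               ∎)
  where
  open ≡-Reasoning
  false≢true : false ≡ true → ⊥
  false≢true ()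

fullAdder-needs-two-gates : ∀ {n} (c : Circuit n) (s co : OutLit n) →
  ImplementsFullAdder c s co → 2 ≤ n
fullAdder-needs-two-gates {zero}        c (out _ ()) co impl
fullAdder-needs-two-gates {suc zero}    c (out s Fin.zero) (out t Fin.zero) impl
  with () ← fullAdder-outputs-distinct-gates c s t Fin.zero impl
fullAdder-needs-two-gates {suc (suc n)} c s co impl = s≤s (s≤s z≤n)

theorem3 : ImplementsFullAdder faCircuit faSum faCout
    × (∀ {n} (c : Circuit n) (s co : OutLit n) → ImplementsFullAdder c s co → 2 ≤ n)
theorem3 = faCircuit-correct , fullAdder-needs-two-gates
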